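{- For all record types $\rho_1,\rho_2,\rho_3\in\mathbb{T}_R$: (1) if $\rho_1=\rho_2$ then $\mathrm{lbl}(\rho_1)=\mathrm{lbl}(\rho_2)$; (2) if $\mathrm{lbl}(\rho_1)\cap\mathrm{lbl}(\rho_2)=\emptyset$ then $\rho_1+\rho_2=\rho_1\cap\rho_2$; (3) if $\mathrm{lbl}(\rho_1)\subseteq\mathrm{lbl}(\rho_2)$ then $\rho_1+\rho_2=\rho_2$; (4) if $\mathrm{lbl}(\rho_2)=\mathrm{lbl}(\rho_3)$ then $(\rho_1+\rho_2)\cap(\rho_1+\rho_3)=\rho_1+(\rho_2\cap\rho_3)$.
   Context: Types $\mathbb{T}$: $\sigma::=a\mid\omega\mid\sigma\to\sigma\mid\sigma\cap\sigma\mid\rho$; record types $\mathbb{T}_R$: $\rho::=\langle\rangle\mid\langle l:\sigma\rangle\mid\rho+\rho\mid\rho\cap\rho$. Subtyping $\le$ is the least preorder with: $\sigma\le\omega$; $\omega\le\omega\to\omega$; $\sigma\cap\tau\le\sigma$; $\sigma\cap\tau\le\tau$; $\sigma\le\tau_1,\sigma\le\tau_2\Rightarrow\sigma\le\tau_1\cap\tau_2$; $(\sigma\to\tau_1)\cap(\sigma\to\tau_2)\le\sigma\to\tau_1\cap\tau_2$; $\sigma_2\le\sigma_1,\tau_1\le\tau_2\Rightarrow\sigma_1\to\tau_1\le\sigma_2\to\tau_2$; $\langle l:\sigma\rangle\le\langle\rangle$; $\langle l:\sigma\rangle\cap\langle l:\tau\rangle\le\langle l:\sigma\cap\tau\rangle$;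 $\sigma\le\tau\Rightarrow\langle l:\sigma\rangle\le\langle l:\tau\rangle$; and, with $=$ meaning mutual $\le$: $\rho+\langle\rangle=\langle\rangle+\rho=\rho$; $(\rho_1+\rho_2)+\rho_3=\rho_1+(\rho_2+\rho_3)$; $(\rho_1\cap\rho_2)+\rho_3=(\rho_1+\rho_3)\cap(\rho_2+\rho_3)$; $\langle l:\sigma\rangle+(\langle l:\tau\rangle\cap\rho)=\langle l:\tau\rangle\cap\rho$; $\langle l:\sigma\rangle+(\langle l':\tau\rangle\cap\rho)=\langle l':\tau\rangle\cap(\langle l:\sigma\rangle+\rho)$ if $l\ne l'$; $\rho_1\le\rho_2\Rightarrow\rho_1+\rho\le\rho_2+\rho$; $\rho_1=\rho_2\Rightarrow\rho+\rho_1=\rho+\rho_2$. Labels of record types: $\mathrm{lbl}(\langle\rangle)=\emptyset$, $\mathrm{lbl}(\langle l:\sigma\rangle)=\{l\}$, $\mathrm{lbl}(\rho_1\cap\rho_2)=\mathrm{lbl}(\rho_1+\rho_2)=\mathrm{lbl}(\rho_1)\cup\mathrm{lbl}(\rho_2)$. -}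

module Defs where

open import Data.Nat using (ℕ)
open import Data.Empty using (⊥)
open import Data.Sum using (_⊎_)
open import Data.Product using (_×_)
open import Relation.Binary.PropositionalEquality using (_≡_)

Label : Set
Label = ℕ

Atom : Set
Atom = ℕ

infixr 7 _⇒_
infixl 8 _∩_
infixl 9 _+ᴿ_

-- Raw type syntax; the grammars 𝕋 and 𝕋_R are carved out by IsT / IsR.
data Ty : Set where
  atom  : Atom → Ty
  ω     : Ty
  _⇒_   : Ty → Ty → Ty
  _∩_   : Ty → Ty → Ty
  ⟨⟩    : Ty
  ⟨_∶_⟩ : Label → Ty → Ty
  _+ᴿ_  : Ty → Ty → Ty

mutual
  data IsT : Ty → Set where
    t-atom : ∀ a → IsT (atom a)
    t-ω    : IsT ω
    t-⇒    : ∀ {σ τ} → IsT σ → IsT τ → IsT (σ ⇒ τ)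
    t-∩    : ∀ {σ τ} → IsT σ → IsT τ → IsT (σ ∩ τ)
    t-rec  : ∀ {ρ} → IsR ρ → IsT ρ

  data IsR : Ty → Set where
    r-⟨⟩ : IsR ⟨⟩
    r-l  : ∀ l {σ} → IsT σ → IsR ⟨ l ∶ σ ⟩
    r-+  : ∀ {ρ₁ ρ₂} → IsR ρ₁ → IsR ρ₂ → IsR (ρ₁ +ᴿ ρ₂)
    r-∩  : ∀ {ρ₁ ρ₂} → IsR ρ₁ → IsR ρ₂ → IsR (ρ₁ ∩ ρ₂)

-- Membership in lbl(ρ) (lbl(ρ) as a predicate on labels).
-- Only meaningful on record types; non-record constructors get ∅.
lbl : Ty → Label → Set
lbl (atom a)    l = ⊥
lbl ω           l = ⊥
lbl (σ ⇒ τ)     l = ⊥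
lbl (ρ₁ ∩ ρ₂)   l = lbl ρ₁ l ⊎ lbl ρ₂ l
lbl ⟨⟩          l = ⊥
lbl ⟨ l' ∶ σ ⟩  l = l ≡ l'
lbl (ρ₁ +ᴿ ρ₂)  l = lbl ρ₁ l ⊎ lbl ρ₂ l

infix 4 _≤_ _≃_

-- Every axiom carries well-formedness premises so only types of 𝕋 are related.
-- Each equation "A = B" of the paper contributes two constructors (A ≤ B, B ≤ A).
data _≤_ : Ty → Ty → Set where
  ≤-refl   : ∀ {σ} → IsT σ → σ ≤ σ
  ≤-trans  : ∀ {σ τ υ} → σ ≤ τ → τ ≤ υ → σ ≤ υ
  ≤-ω      : ∀ {σ} → IsT σ → σ ≤ ω
  ω≤ω⇒ω    : ω ≤ ω ⇒ ω
  ∩≤ˡ      : ∀ {σ τ} → IsT σ → IsT τ → σ ∩ τ ≤ σ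
  ∩≤ʳ      : ∀ {σ τ} → IsT σ → IsT τ → σ ∩ τ ≤ τ
  ≤-∩      : ∀ {σ τ₁ τ₂} → σ ≤ τ₁ → σ ≤ τ₂ → σ ≤ τ₁ ∩ τ₂
  ⇒-∩      : ∀ {σ τ₁ τ₂} → IsT σ → IsT τ₁ → IsT τ₂ →
             (σ ⇒ τ₁) ∩ (σ ⇒ τ₂) ≤ σ ⇒ (τ₁ ∩ τ₂)
  ⇒-mono   : ∀ {σ₁ σ₂ τ₁ τ₂} → σ₂ ≤ σ₁ → τ₁ ≤ τ₂ → σ₁ ⇒ τ₁ ≤ σ₂ ⇒ τ₂
  l≤⟨⟩     : ∀ {l σ} → IsT σ → ⟨ l ∶ σ ⟩ ≤ ⟨⟩
  l-∩      : ∀ {l σ τ} → IsT σ → IsT τ → ⟨ l ∶ σ ⟩ ∩ ⟨ l ∶ τ ⟩ ≤ ⟨ l ∶ σ ∩ τ ⟩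
  l-mono   : ∀ {l σ τ} → σ ≤ τ → ⟨ l ∶ σ ⟩ ≤ ⟨ l ∶ τ ⟩
  +⟨⟩≤     : ∀ {ρ} → IsR ρ → ρ +ᴿ ⟨⟩ ≤ ρ
  +⟨⟩≥     : ∀ {ρ} → IsR ρ → ρ ≤ ρ +ᴿ ⟨⟩
  ⟨⟩+≤     : ∀ {ρ} → IsR ρ → ⟨⟩ +ᴿ ρ ≤ ρ
  ⟨⟩+≥     : ∀ {ρ} → IsR ρ → ρ ≤ ⟨⟩ +ᴿ ρ
  +-assoc≤ : ∀ {ρ₁ ρ₂ ρ₃} → IsR ρ₁ → IsR ρ₂ → IsR ρ₃ →
             (ρ₁ +ᴿ ρ₂) +ᴿ ρ₃ ≤ ρ₁ +ᴿ (ρ₂ +ᴿ ρ₃)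
  +-assoc≥ : ∀ {ρ₁ ρ₂ ρ₃} → IsR ρ₁ → IsR ρ₂ → IsR ρ₃ →
             ρ₁ +ᴿ (ρ₂ +ᴿ ρ₃) ≤ (ρ₁ +ᴿ ρ₂) +ᴿ ρ₃
  ∩+≤      : ∀ {ρ₁ ρ₂ ρ₃} → IsR ρ₁ → IsR ρ₂ → IsR ρ₃ →
             (ρ₁ ∩ ρ₂) +ᴿ ρ₃ ≤ (ρ₁ +ᴿ ρ₃) ∩ (ρ₂ +ᴿ ρ₃)
  ∩+≥      : ∀ {ρ₁ ρ₂ ρ₃} → IsR ρ₁ → IsR ρ₂ → IsR ρ₃ →
             (ρ₁ +ᴿ ρ₃) ∩ (ρ₂ +ᴿ ρ₃) ≤ (ρ₁ ∩ ρ₂) +ᴿ ρ₃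
  +same≤   : ∀ {l σ τ ρ} → IsT σ → IsT τ → IsR ρ →
             ⟨ l ∶ σ ⟩ +ᴿ (⟨ l ∶ τ ⟩ ∩ ρ) ≤ ⟨ l ∶ τ ⟩ ∩ ρ
  +same≥   : ∀ {l σ τ ρ} → IsT σ → IsT τ → IsR ρ →
             ⟨ l ∶ τ ⟩ ∩ ρ ≤ ⟨ l ∶ σ ⟩ +ᴿ (⟨ l ∶ τ ⟩ ∩ ρ)
  +diff≤   : ∀ {l l' σ τ ρ} → (l ≡ l' → ⊥) → IsT σ → IsT τ → IsR ρ →
             ⟨ l ∶ σ ⟩ +ᴿ (⟨ l' ∶ τ ⟩ ∩ ρ) ≤ ⟨ l' ∶ τ ⟩ ∩ (⟨ l ∶ σ ⟩ +ᴿ ρ)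
  +diff≥   : ∀ {l l' σ τ ρ} → (l ≡ l' → ⊥) → IsT σ → IsT τ → IsR ρ →
             ⟨ l' ∶ τ ⟩ ∩ (⟨ l ∶ σ ⟩ +ᴿ ρ) ≤ ⟨ l ∶ σ ⟩ +ᴿ (⟨ l' ∶ τ ⟩ ∩ ρ)
  +-monoˡ  : ∀ {ρ₁ ρ₂ ρ} → IsR ρ₁ → IsR ρ₂ → IsR ρ → ρ₁ ≤ ρ₂ → ρ₁ +ᴿ ρ ≤ ρ₂ +ᴿ ρ
  -- ρ₁ = ρ₂ ⇒ ρ + ρ₁ = ρ + ρ₂ (both directions of the conclusion)
  +-congʳ≤ : ∀ {ρ₁ ρ₂ ρ} → IsR ρ₁ → IsR ρ₂ → IsR ρ →
             ρ₁ ≤ ρ₂ → ρ₂ ≤ ρ₁ → ρ +ᴿ ρ₁ ≤ ρ +ᴿ ρ₂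
  +-congʳ≥ : ∀ {ρ₁ ρ₂ ρ} → IsR ρ₁ → IsR ρ₂ → IsR ρ →
             ρ₁ ≤ ρ₂ → ρ₂ ≤ ρ₁ → ρ +ᴿ ρ₂ ≤ ρ +ᴿ ρ₁

_≃_ : Ty → Ty → Set
σ ≃ τ = σ ≤ τ × τ ≤ σ

-- If σ ≤ τ then lbl(τ) ⊆ lbl(σ), since no rule introduces a field on its right side; so
-- equal record types have equal labels and label hypotheses can be moved along ≃.
-- Every record type equals a normal form ⟨l₁:σ₁⟩ ∩ (… ∩ (⟨lₙ:σₙ⟩ ∩ ⟨⟩)), and against a
-- normal form N the two axioms for ⟨l:σ⟩ + (⟨l':τ⟩ ∩ ρ) compute ⟨l:σ⟩ + N: it is N if
-- l ∈ lbl(N) and ⟨l:σ⟩ ∩ N otherwise. Since + distributes over ∩ from the right, the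
-- remaining statements reduce, field by field of (a normal form of) ρ₁, to this
-- computation plus commutative-idempotent bookkeeping for ∩.
module Submission where

open import Defs
open import Data.Empty using (⊥)
open import Data.Product using (_×_; _,_; proj₁; proj₂; Σ)
open import Data.Sum using (inj₁; inj₂; [_,_]′; map; map₁; map₂; fromInj₁; fromInj₂; assocˡ; assocʳ)
open import Data.Nat using (_≟_)
open import Function using (_∘_; id)
open import Function.Bundles using (_⇔_; mk⇔; Equivalence)
open import Relation.Nullary using (¬_; Dec; yes; no)
open import Relation.Nullary.Decidable using (_⊎-dec_)
open import Relation.Binary.Bundles using (PartialSetoid)
open import Relation.Binary.PropositionalEquality using (refl)
import Relation.Binary.Reasoning.PartialSetoid as PartialSetoidReasoning

≤-wellFormed : ∀ {σ τ} → σ ≤ τ → IsT σ × IsT τ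
≤-wellFormed (≤-refl t) = t , t
≤-wellFormed (≤-trans p q) = proj₁ (≤-wellFormed p) , proj₂ (≤-wellFormed q)
≤-wellFormed (≤-ω t) = t , t-ω
≤-wellFormed ω≤ω⇒ω = t-ω , t-⇒ t-ω t-ω
≤-wellFormed (∩≤ˡ a b) = t-∩ a b , a
≤-wellFormed (∩≤ʳ a b) = t-∩ a b , b
≤-wellFormed (≤-∩ p q) =
  proj₁ (≤-wellFormed p) , t-∩ (proj₂ (≤-wellFormed p)) (proj₂ (≤-wellFormed q))
≤-wellFormed (⇒-∩ a b c) = t-∩ (t-⇒ a b) (t-⇒ a c) , t-⇒ a (t-∩ b c)
≤-wellFormed (⇒-mono p q) =
  t-⇒ (proj₂ (≤-wellFormed p)) (proj₁ (≤-wellFormed q)) ,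
  t-⇒ (proj₁ (≤-wellFormed p)) (proj₂ (≤-wellFormed q))
≤-wellFormed (l≤⟨⟩ t) = t-rec (r-l _ t) , t-rec r-⟨⟩
≤-wellFormed (l-∩ a b) = t-∩ (t-rec (r-l _ a)) (t-rec (r-l _ b)) , t-rec (r-l _ (t-∩ a b))
≤-wellFormed (l-mono p) =
  t-rec (r-l _ (proj₁ (≤-wellFormed p))) , t-rec (r-l _ (proj₂ (≤-wellFormed p)))
≤-wellFormed (+⟨⟩≤ r) = t-rec (r-+ r r-⟨⟩) , t-rec r
≤-wellFormed (+⟨⟩≥ r) = t-rec r , t-rec (r-+ r r-⟨⟩)
≤-wellFormed (⟨⟩+≤ r) = t-rec (r-+ r-⟨⟩ r) , t-rec r
≤-wellFormed (⟨⟩+≥ r) = t-rec r , t-rec (r-+ r-⟨⟩ r)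
≤-wellFormed (+-assoc≤ a b c) = t-rec (r-+ (r-+ a b) c) , t-rec (r-+ a (r-+ b c))
≤-wellFormed (+-assoc≥ a b c) = t-rec (r-+ a (r-+ b c)) , t-rec (r-+ (r-+ a b) c)
≤-wellFormed (∩+≤ a b c) = t-rec (r-+ (r-∩ a b) c) , t-rec (r-∩ (r-+ a c) (r-+ b c))
≤-wellFormed (∩+≥ a b c) = t-rec (r-∩ (r-+ a c) (r-+ b c)) , t-rec (r-+ (r-∩ a b) c)
≤-wellFormed (+same≤ s t r) = t-rec (r-+ (r-l _ s) (r-∩ (r-l _ t) r)) , t-rec (r-∩ (r-l _ t) r)
≤-wellFormed (+same≥ s t r) = t-rec (r-∩ (r-l _ t) r) , t-rec (r-+ (r-l _ s) (r-∩ (r-l _ t) r))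
≤-wellFormed (+diff≤ _ s t r) =
  t-rec (r-+ (r-l _ s) (r-∩ (r-l _ t) r)) , t-rec (r-∩ (r-l _ t) (r-+ (r-l _ s) r))
≤-wellFormed (+diff≥ _ s t r) =
  t-rec (r-∩ (r-l _ t) (r-+ (r-l _ s) r)) , t-rec (r-+ (r-l _ s) (r-∩ (r-l _ t) r))
≤-wellFormed (+-monoˡ a b c _) = t-rec (r-+ a c) , t-rec (r-+ b c)
≤-wellFormed (+-congʳ≤ a b c _ _) = t-rec (r-+ c a) , t-rec (r-+ c b)
≤-wellFormed (+-congʳ≥ a b c _ _) = t-rec (r-+ c b) , t-rec (r-+ c a)

lbl-antitone : ∀ {σ τ} → σ ≤ τ → ∀ l → lbl τ l → lbl σ l
lbl-antitone (≤-refl _) l = id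
lbl-antitone (≤-trans p q) l = lbl-antitone p l ∘ lbl-antitone q l
lbl-antitone (≤-ω _) l ()
lbl-antitone ω≤ω⇒ω l ()
lbl-antitone (∩≤ˡ _ _) l = inj₁
lbl-antitone (∩≤ʳ _ _) l = inj₂
lbl-antitone (≤-∩ p q) l = [ lbl-antitone p l , lbl-antitone q l ]′
lbl-antitone (⇒-∩ _ _ _) l ()
lbl-antitone (⇒-mono _ _) l ()
lbl-antitone (l≤⟨⟩ _) l ()
lbl-antitone (l-∩ _ _) l = inj₁
lbl-antitone (l-mono _) l = id
lbl-antitone (+⟨⟩≤ _) l = inj₁
lbl-antitone (+⟨⟩≥ _) l = fromInj₁ λ ()
lbl-antitone (⟨⟩+≤ _) l = inj₂
lbl-antitone (⟨⟩+≥ _) l = fromInj₂ λ ()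
lbl-antitone (+-assoc≤ _ _ _) l = assocˡ
lbl-antitone (+-assoc≥ _ _ _) l = assocʳ
lbl-antitone (∩+≤ _ _ _) l = [ map₁ inj₁ , map₁ inj₂ ]′
lbl-antitone (∩+≥ _ _ _) l = [ map inj₁ inj₁ , inj₁ ∘ inj₂ ]′
lbl-antitone (+same≤ _ _ _) l = inj₂
lbl-antitone (+same≥ _ _ _) l = [ inj₁ , id ]′
lbl-antitone (+diff≤ _ _ _ _) l = [ inj₂ ∘ inj₁ , map₂ inj₂ ]′
lbl-antitone (+diff≥ _ _ _ _) l = [ inj₂ ∘ inj₁ , map₂ inj₂ ]′
lbl-antitone (+-monoˡ _ _ _ p) l = map₁ (lbl-antitone p l)
lbl-antitone (+-congʳ≤ _ _ _ p _) l = map₂ (lbl-antitone p l)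
lbl-antitone (+-congʳ≥ _ _ _ _ q) l = map₂ (lbl-antitone q l)

lbl? : ∀ ρ l → Dec (lbl ρ l)
lbl? (atom a) l = no λ ()
lbl? ω l = no λ ()
lbl? (σ ⇒ τ) l = no λ ()
lbl? (ρ₁ ∩ ρ₂) l = lbl? ρ₁ l ⊎-dec lbl? ρ₂ l
lbl? ⟨⟩ l = no λ ()
lbl? ⟨ l' ∶ σ ⟩ l = l ≟ l'
lbl? (ρ₁ +ᴿ ρ₂) l = lbl? ρ₁ l ⊎-dec lbl? ρ₂ l

_⊆ₗ_ _#ₗ_ _≈ₗ_ : Ty → Ty → Set
ρ₁ ⊆ₗ ρ₂ = ∀ l → lbl ρ₁ l → lbl ρ₂ l
ρ₁ #ₗ ρ₂ = ∀ l → lbl ρ₁ l → lbl ρ₂ l → ⊥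
ρ₁ ≈ₗ ρ₂ = ∀ l → lbl ρ₁ l ⇔ lbl ρ₂ l

≃⇒≈ₗ : ∀ {ρ₁ ρ₂} → ρ₁ ≃ ρ₂ → ρ₁ ≈ₗ ρ₂
≃⇒≈ₗ (p , q) l = mk⇔ (lbl-antitone q l) (lbl-antitone p l)

≃-refl : ∀ {σ} → IsT σ → σ ≃ σ
≃-refl t = ≤-refl t , ≤-refl t

≃-sym : ∀ {σ τ} → σ ≃ τ → τ ≃ σ
≃-sym (p , q) = q , p

infixr 5 _⊙_
_⊙_ : ∀ {σ τ υ} → σ ≃ τ → τ ≃ υ → σ ≃ υ
(p , p') ⊙ (q , q') = ≤-trans p q , ≤-trans q' p'

≃-partialSetoid : PartialSetoid _ _
≃-partialSetoid = record
  { Carrier = Ty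
  ; _≈_ = _≃_
  ; isPartialEquivalence = record { sym = ≃-sym ; trans = _⊙_ }
  }

module ≃-Reasoning = PartialSetoidReasoning ≃-partialSetoid

≤-⟨⟩ : ∀ {ρ} → IsR ρ → ρ ≤ ⟨⟩
≤-⟨⟩ r-⟨⟩ = ≤-refl (t-rec r-⟨⟩)
≤-⟨⟩ (r-l l t) = l≤⟨⟩ t
≤-⟨⟩ (r-+ a b) = ≤-trans (+-monoˡ a r-⟨⟩ b (≤-⟨⟩ a)) (≤-trans (⟨⟩+≤ b) (≤-⟨⟩ b))
≤-⟨⟩ (r-∩ a b) = ≤-trans (∩≤ˡ (t-rec a) (t-rec b)) (≤-⟨⟩ a)

∩-mono : ∀ {σ σ' τ τ'} → σ ≤ σ' → τ ≤ τ' → σ ∩ τ ≤ σ' ∩ τ'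
∩-mono p q = ≤-∩ (≤-trans (∩≤ˡ s t) p) (≤-trans (∩≤ʳ s t) q)
  where s = proj₁ (≤-wellFormed p)
        t = proj₁ (≤-wellFormed q)

∩-cong : ∀ {σ σ' τ τ'} → σ ≃ σ' → τ ≃ τ' → σ ∩ τ ≃ σ' ∩ τ'
∩-cong (p , p') (q , q') = ∩-mono p q , ∩-mono p' q'

∩-idem : ∀ {σ} → IsT σ → σ ∩ σ ≃ σ
∩-idem t = ∩≤ˡ t t , ≤-∩ (≤-refl t) (≤-refl t)

∩-comm : ∀ {σ τ} → IsT σ → IsT τ → σ ∩ τ ≃ τ ∩ σ
∩-comm s t = ≤-∩ (∩≤ʳ s t) (∩≤ˡ s t) , ≤-∩ (∩≤ʳ t s) (∩≤ˡ t s)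

∩-assoc : ∀ {σ τ υ} → IsT σ → IsT τ → IsT υ → (σ ∩ τ) ∩ υ ≃ σ ∩ (τ ∩ υ)
∩-assoc s t u =
  ≤-∩ (≤-trans (∩≤ˡ (t-∩ s t) u) (∩≤ˡ s t))
      (≤-∩ (≤-trans (∩≤ˡ (t-∩ s t) u) (∩≤ʳ s t)) (∩≤ʳ (t-∩ s t) u)) ,
  ≤-∩ (≤-∩ (∩≤ˡ s (t-∩ t u)) (≤-trans (∩≤ʳ s (t-∩ t u)) (∩≤ˡ t u)))
      (≤-trans (∩≤ʳ s (t-∩ t u)) (∩≤ʳ t u))

∩-leftComm : ∀ {σ τ υ} → IsT σ → IsT τ → IsT υ → σ ∩ (τ ∩ υ) ≃ τ ∩ (σ ∩ υ)
∩-leftComm s t u = ≃-sym (∩-assoc s t u) ⊙ ∩-cong (∩-comm s t) (≃-refl u) ⊙ ∩-assoc t s u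

∩-interchange : ∀ {σ τ υ φ} → IsT σ → IsT τ → IsT υ → IsT φ →
                (σ ∩ τ) ∩ (υ ∩ φ) ≃ (σ ∩ υ) ∩ (τ ∩ φ)
∩-interchange s t u f =
  ∩-assoc s t (t-∩ u f) ⊙ ∩-cong (≃-refl s) (∩-leftComm t u f) ⊙ ≃-sym (∩-assoc s u (t-∩ t f))

∩-identityˡ : ∀ {ρ} → IsR ρ → ⟨⟩ ∩ ρ ≃ ρ
∩-identityˡ r = ∩≤ʳ (t-rec r-⟨⟩) (t-rec r) , ≤-∩ (≤-⟨⟩ r) (≤-refl (t-rec r))

∩-identityʳ : ∀ {ρ} → IsR ρ → ρ ∩ ⟨⟩ ≃ ρ
∩-identityʳ r = ∩≤ˡ (t-rec r) (t-rec r-⟨⟩) , ≤-∩ (≤-refl (t-rec r)) (≤-⟨⟩ r)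

+-identityˡ : ∀ {ρ} → IsR ρ → ⟨⟩ +ᴿ ρ ≃ ρ
+-identityˡ r = ⟨⟩+≤ r , ⟨⟩+≥ r

+-identityʳ : ∀ {ρ} → IsR ρ → ρ +ᴿ ⟨⟩ ≃ ρ
+-identityʳ r = +⟨⟩≤ r , +⟨⟩≥ r

+-assoc : ∀ {ρ₁ ρ₂ ρ₃} → IsR ρ₁ → IsR ρ₂ → IsR ρ₃ → (ρ₁ +ᴿ ρ₂) +ᴿ ρ₃ ≃ ρ₁ +ᴿ (ρ₂ +ᴿ ρ₃)
+-assoc a b c = +-assoc≤ a b c , +-assoc≥ a b c

+-distribʳ-∩ : ∀ {ρ₁ ρ₂ ρ₃} → IsR ρ₁ → IsR ρ₂ → IsR ρ₃ →
               (ρ₁ ∩ ρ₂) +ᴿ ρ₃ ≃ (ρ₁ +ᴿ ρ₃) ∩ (ρ₂ +ᴿ ρ₃)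
+-distribʳ-∩ a b c = ∩+≤ a b c , ∩+≥ a b c

+-congʳ : ∀ {ρ₁ ρ₂ ρ} → IsR ρ₁ → IsR ρ₂ → IsR ρ → ρ₁ ≃ ρ₂ → ρ₁ +ᴿ ρ ≃ ρ₂ +ᴿ ρ
+-congʳ a b r (p , q) = +-monoˡ a b r p , +-monoˡ b a r q

+-congˡ : ∀ {ρ₁ ρ₂ ρ} → IsR ρ₁ → IsR ρ₂ → IsR ρ → ρ₁ ≃ ρ₂ → ρ +ᴿ ρ₁ ≃ ρ +ᴿ ρ₂
+-congˡ a b r (p , q) = +-congʳ≤ a b r p q , +-congʳ≥ a b r p q

data IsNormal : Ty → Set where
  nf-⟨⟩ : IsNormal ⟨⟩
  nf-∩  : ∀ l {σ ρ} → IsT σ → IsNormal ρ → IsNormal (⟨ l ∶ σ ⟩ ∩ ρ)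

IsNormal⇒IsR : ∀ {ρ} → IsNormal ρ → IsR ρ
IsNormal⇒IsR nf-⟨⟩ = r-⟨⟩
IsNormal⇒IsR (nf-∩ l t n) = r-∩ (r-l l t) (IsNormal⇒IsR n)

IsNormal⇒IsT : ∀ {ρ} → IsNormal ρ → IsT ρ
IsNormal⇒IsT = t-rec ∘ IsNormal⇒IsR

NormalForm : Ty → Set
NormalForm ρ = Σ Ty λ N → IsNormal N × ρ ≃ N

⟨∶⟩+-present-normal : ∀ l {σ N} → IsT σ → IsNormal N → lbl N l → ⟨ l ∶ σ ⟩ +ᴿ N ≃ N
⟨∶⟩+-present-normal l s (nf-∩ l' t n) (inj₁ refl) =
  +same≤ s t (IsNormal⇒IsR n) , +same≥ s t (IsNormal⇒IsR n)
⟨∶⟩+-present-normal l s (nf-∩ l' t n) (inj₂ l∈n) with l ≟ l'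
... | yes refl = +same≤ s t (IsNormal⇒IsR n) , +same≥ s t (IsNormal⇒IsR n)
... | no l≢l' =
  (+diff≤ l≢l' s t (IsNormal⇒IsR n) , +diff≥ l≢l' s t (IsNormal⇒IsR n))
  ⊙ ∩-cong (≃-refl (t-rec (r-l l' t))) (⟨∶⟩+-present-normal l s n l∈n)

⟨∶⟩+-absent-normal : ∀ l {σ N} → IsT σ → IsNormal N → ¬ lbl N l → ⟨ l ∶ σ ⟩ +ᴿ N ≃ ⟨ l ∶ σ ⟩ ∩ N
⟨∶⟩+-absent-normal l s nf-⟨⟩ _ = +-identityʳ (r-l l s) ⊙ ≃-sym (∩-identityʳ (r-l l s))
⟨∶⟩+-absent-normal l s (nf-∩ l' t n) l∉N =
  (+diff≤ l≢l' s t (IsNormal⇒IsR n) , +diff≥ l≢l' s t (IsNormal⇒IsR n))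
  ⊙ ∩-cong (≃-refl (t-rec (r-l l' t))) (⟨∶⟩+-absent-normal l s n (l∉N ∘ inj₂))
  ⊙ ∩-leftComm (t-rec (r-l l' t)) (t-rec (r-l l s)) (IsNormal⇒IsT n)
  where l≢l' = l∉N ∘ inj₁

∩-normal : ∀ {A B} → IsNormal A → IsNormal B → NormalForm (A ∩ B)
∩-normal {B = B} nf-⟨⟩ b = B , b , ∩-identityˡ (IsNormal⇒IsR b)
∩-normal (nf-∩ l t a) b with ∩-normal a b
... | N , n , e = _ , nf-∩ l t n ,
  ∩-assoc (t-rec (r-l l t)) (IsNormal⇒IsT a) (IsNormal⇒IsT b) ⊙ ∩-cong (≃-refl (t-rec (r-l l t))) e

⟨∶⟩+-normal : ∀ l {σ B} → IsT σ → IsNormal B → NormalForm (⟨ l ∶ σ ⟩ +ᴿ B)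
⟨∶⟩+-normal l {B = B} s b with lbl? B l
... | yes l∈B = B , b , ⟨∶⟩+-present-normal l s b l∈B
... | no l∉B = _ , nf-∩ l s b , ⟨∶⟩+-absent-normal l s b l∉B

+-normal : ∀ {A B} → IsNormal A → IsNormal B → NormalForm (A +ᴿ B)
+-normal {B = B} nf-⟨⟩ b = B , b , +-identityˡ (IsNormal⇒IsR b)
+-normal (nf-∩ l t a) b with ⟨∶⟩+-normal l t b | +-normal a b
... | N₁ , n₁ , e₁ | N₂ , n₂ , e₂ with ∩-normal n₁ n₂
... | N , n , e = N , n ,
  +-distribʳ-∩ (r-l l t) (IsNormal⇒IsR a) (IsNormal⇒IsR b) ⊙ ∩-cong e₁ e₂ ⊙ e

normalise : ∀ {ρ} → IsR ρ → NormalForm ρ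
normalise r-⟨⟩ = ⟨⟩ , nf-⟨⟩ , ≃-refl (t-rec r-⟨⟩)
normalise (r-l l t) = _ , nf-∩ l t nf-⟨⟩ , ≃-sym (∩-identityʳ (r-l l t))
normalise (r-∩ r₁ r₂) with normalise r₁ | normalise r₂
... | A , a , e₁ | B , b , e₂ with ∩-normal a b
... | N , n , e = N , n , ∩-cong e₁ e₂ ⊙ e
normalise (r-+ r₁ r₂) with normalise r₁ | normalise r₂
... | A , a , e₁ | B , b , e₂ with +-normal a b
... | N , n , e = N , n ,
  +-congʳ r₁ (IsNormal⇒IsR a) r₂ e₁ ⊙ +-congˡ r₂ (IsNormal⇒IsR b) (IsNormal⇒IsR a) e₂ ⊙ e

⟨∶⟩+-present : ∀ l {σ ρ} → IsT σ → IsR ρ → lbl ρ l → ⟨ l ∶ σ ⟩ +ᴿ ρ ≃ ρ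
⟨∶⟩+-present l s r l∈ρ with normalise r
... | N , n , e =
  +-congˡ r (IsNormal⇒IsR n) (r-l l s) e
  ⊙ ⟨∶⟩+-present-normal l s n (lbl-antitone (proj₂ e) l l∈ρ)
  ⊙ ≃-sym e

⟨∶⟩+-absent : ∀ l {σ ρ} → IsT σ → IsR ρ → ¬ lbl ρ l → ⟨ l ∶ σ ⟩ +ᴿ ρ ≃ ⟨ l ∶ σ ⟩ ∩ ρ
⟨∶⟩+-absent l s r l∉ρ with normalise r
... | N , n , e =
  +-congˡ r (IsNormal⇒IsR n) (r-l l s) e
  ⊙ ⟨∶⟩+-absent-normal l s n (l∉ρ ∘ lbl-antitone (proj₁ e) l)
  ⊙ ∩-cong (≃-refl (t-rec (r-l l s))) (≃-sym e)

-- + is right-biased record extension: the fields of ρ₂ override those of ρ₁.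
⊆ₗ⇒+-overridden : ∀ {ρ₁ ρ₂} → IsR ρ₁ → IsR ρ₂ → ρ₁ ⊆ₗ ρ₂ → ρ₁ +ᴿ ρ₂ ≃ ρ₂
⊆ₗ⇒+-overridden r-⟨⟩ r₂ _ = +-identityˡ r₂
⊆ₗ⇒+-overridden (r-l l s) r₂ ⊆ = ⟨∶⟩+-present l s r₂ (⊆ l refl)
⊆ₗ⇒+-overridden (r-∩ a b) r₂ ⊆ =
  +-distribʳ-∩ a b r₂
  ⊙ ∩-cong (⊆ₗ⇒+-overridden a r₂ (λ l → ⊆ l ∘ inj₁)) (⊆ₗ⇒+-overridden b r₂ (λ l → ⊆ l ∘ inj₂))
  ⊙ ∩-idem (t-rec r₂)
⊆ₗ⇒+-overridden (r-+ a b) r₂ ⊆ =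
  +-assoc a b r₂
  ⊙ +-congˡ (r-+ b r₂) r₂ a (⊆ₗ⇒+-overridden b r₂ (λ l → ⊆ l ∘ inj₂))
  ⊙ ⊆ₗ⇒+-overridden a r₂ (λ l → ⊆ l ∘ inj₁)

#ₗ⇒+≃∩-normal : ∀ {A ρ} → IsNormal A → IsR ρ → A #ₗ ρ → A +ᴿ ρ ≃ A ∩ ρ
#ₗ⇒+≃∩-normal nf-⟨⟩ r _ = +-identityˡ r ⊙ ≃-sym (∩-identityˡ r)
#ₗ⇒+≃∩-normal {ρ = ρ} (nf-∩ l {σ} {A} s a) r # = begin
  (⟨ l ∶ σ ⟩ ∩ A) +ᴿ ρ         ≈⟨ +-distribʳ-∩ (r-l l s) (IsNormal⇒IsR a) r ⟩
  (⟨ l ∶ σ ⟩ +ᴿ ρ) ∩ (A +ᴿ ρ)  ≈⟨ ∩-cong (⟨∶⟩+-absent l s r (# l (inj₁ refl)))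
                                         (#ₗ⇒+≃∩-normal a r (λ l → # l ∘ inj₂)) ⟩
  (⟨ l ∶ σ ⟩ ∩ ρ) ∩ (A ∩ ρ)    ≈⟨ ∩-interchange (t-rec (r-l l s)) t (IsNormal⇒IsT a) t ⟩
  (⟨ l ∶ σ ⟩ ∩ A) ∩ (ρ ∩ ρ)    ≈⟨ ∩-cong (≃-refl (IsNormal⇒IsT (nf-∩ l s a))) (∩-idem t) ⟩
  (⟨ l ∶ σ ⟩ ∩ A) ∩ ρ          ∎
  where open ≃-Reasoning
        t = t-rec r

#ₗ⇒+≃∩ : ∀ {ρ₁ ρ₂} → IsR ρ₁ → IsR ρ₂ → ρ₁ #ₗ ρ₂ → ρ₁ +ᴿ ρ₂ ≃ ρ₁ ∩ ρ₂
#ₗ⇒+≃∩ r₁ r₂ # with normalise r₁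
... | A , a , e =
  +-congʳ r₁ (IsNormal⇒IsR a) r₂ e
  ⊙ #ₗ⇒+≃∩-normal a r₂ (λ l → # l ∘ lbl-antitone (proj₁ e) l)
  ⊙ ≃-sym (∩-cong e (≃-refl (t-rec r₂)))

⟨∶⟩+-distribˡ-∩ : ∀ l {σ ρ₂ ρ₃} → IsT σ → IsR ρ₂ → IsR ρ₃ → ρ₂ ≈ₗ ρ₃ →
                  (⟨ l ∶ σ ⟩ +ᴿ ρ₂) ∩ (⟨ l ∶ σ ⟩ +ᴿ ρ₃) ≃ ⟨ l ∶ σ ⟩ +ᴿ (ρ₂ ∩ ρ₃)
⟨∶⟩+-distribˡ-∩ l {σ} {ρ₂} {ρ₃} s r₂ r₃ ≈ with lbl? ρ₂ l
... | yes l∈ρ₂ =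
  ∩-cong (⟨∶⟩+-present l s r₂ l∈ρ₂) (⟨∶⟩+-present l s r₃ (Equivalence.to (≈ l) l∈ρ₂))
  ⊙ ≃-sym (⟨∶⟩+-present l s (r-∩ r₂ r₃) (inj₁ l∈ρ₂))
... | no l∉ρ₂ = begin
  (⟨ l ∶ σ ⟩ +ᴿ ρ₂) ∩ (⟨ l ∶ σ ⟩ +ᴿ ρ₃)
    ≈⟨ ∩-cong (⟨∶⟩+-absent l s r₂ l∉ρ₂) (⟨∶⟩+-absent l s r₃ l∉ρ₃) ⟩
  (⟨ l ∶ σ ⟩ ∩ ρ₂) ∩ (⟨ l ∶ σ ⟩ ∩ ρ₃)
    ≈⟨ ∩-interchange f (t-rec r₂) f (t-rec r₃) ⟩
  (⟨ l ∶ σ ⟩ ∩ ⟨ l ∶ σ ⟩) ∩ (ρ₂ ∩ ρ₃)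
    ≈⟨ ∩-cong (∩-idem f) (≃-refl (t-∩ (t-rec r₂) (t-rec r₃))) ⟩
  ⟨ l ∶ σ ⟩ ∩ (ρ₂ ∩ ρ₃)
    ≈˘⟨ ⟨∶⟩+-absent l s (r-∩ r₂ r₃) [ l∉ρ₂ , l∉ρ₃ ]′ ⟩
  ⟨ l ∶ σ ⟩ +ᴿ (ρ₂ ∩ ρ₃)
    ∎
  where open ≃-Reasoning
        f = t-rec (r-l l s)
        l∉ρ₃ = l∉ρ₂ ∘ Equivalence.from (≈ l)

≈ₗ⇒+-distribˡ-∩-normal : ∀ {A ρ₂ ρ₃} → IsNormal A → IsR ρ₂ → IsR ρ₃ → ρ₂ ≈ₗ ρ₃ →
                         (A +ᴿ ρ₂) ∩ (A +ᴿ ρ₃) ≃ A +ᴿ (ρ₂ ∩ ρ₃)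
≈ₗ⇒+-distribˡ-∩-normal nf-⟨⟩ r₂ r₃ _ =
  ∩-cong (+-identityˡ r₂) (+-identityˡ r₃) ⊙ ≃-sym (+-identityˡ (r-∩ r₂ r₃))
≈ₗ⇒+-distribˡ-∩-normal {ρ₂ = ρ₂} {ρ₃} (nf-∩ l {σ} {A} s a) r₂ r₃ ≈ = begin
  ((⟨ l ∶ σ ⟩ ∩ A) +ᴿ ρ₂) ∩ ((⟨ l ∶ σ ⟩ ∩ A) +ᴿ ρ₃)
    ≈⟨ ∩-cong (+-distribʳ-∩ f ra r₂) (+-distribʳ-∩ f ra r₃) ⟩
  ((⟨ l ∶ σ ⟩ +ᴿ ρ₂) ∩ (A +ᴿ ρ₂)) ∩ ((⟨ l ∶ σ ⟩ +ᴿ ρ₃) ∩ (A +ᴿ ρ₃))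
    ≈⟨ ∩-interchange (t-rec (r-+ f r₂)) (t-rec (r-+ ra r₂)) (t-rec (r-+ f r₃)) (t-rec (r-+ ra r₃)) ⟩
  ((⟨ l ∶ σ ⟩ +ᴿ ρ₂) ∩ (⟨ l ∶ σ ⟩ +ᴿ ρ₃)) ∩ ((A +ᴿ ρ₂) ∩ (A +ᴿ ρ₃))
    ≈⟨ ∩-cong (⟨∶⟩+-distribˡ-∩ l s r₂ r₃ ≈) (≈ₗ⇒+-distribˡ-∩-normal a r₂ r₃ ≈) ⟩
  (⟨ l ∶ σ ⟩ +ᴿ (ρ₂ ∩ ρ₃)) ∩ (A +ᴿ (ρ₂ ∩ ρ₃))
    ≈˘⟨ +-distribʳ-∩ f ra (r-∩ r₂ r₃) ⟩
  (⟨ l ∶ σ ⟩ ∩ A) +ᴿ (ρ₂ ∩ ρ₃)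
    ∎
  where open ≃-Reasoning
        f = r-l l s
        ra = IsNormal⇒IsR a

≈ₗ⇒+-distribˡ-∩ : ∀ {ρ₁ ρ₂ ρ₃} → IsR ρ₁ → IsR ρ₂ → IsR ρ₃ → ρ₂ ≈ₗ ρ₃ →
                  (ρ₁ +ᴿ ρ₂) ∩ (ρ₁ +ᴿ ρ₃) ≃ ρ₁ +ᴿ (ρ₂ ∩ ρ₃)
≈ₗ⇒+-distribˡ-∩ r₁ r₂ r₃ ≈ with normalise r₁
... | A , a , e =
  ∩-cong (+-congʳ r₁ ra r₂ e) (+-congʳ r₁ ra r₃ e)
  ⊙ ≈ₗ⇒+-distribˡ-∩-normal a r₂ r₃ ≈
  ⊙ ≃-sym (+-congʳ r₁ ra (r-∩ r₂ r₃) e)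
  where ra = IsNormal⇒IsR a

lemma3p10 : ∀ ρ₁ ρ₂ ρ₃ → IsR ρ₁ → IsR ρ₂ → IsR ρ₃ →
    (ρ₁ ≃ ρ₂ → ∀ l → lbl ρ₁ l ⇔ lbl ρ₂ l)
  × ((∀ l → lbl ρ₁ l → lbl ρ₂ l → ⊥) → ρ₁ +ᴿ ρ₂ ≃ ρ₁ ∩ ρ₂)
  × ((∀ l → lbl ρ₁ l → lbl ρ₂ l) → ρ₁ +ᴿ ρ₂ ≃ ρ₂)
  × ((∀ l → lbl ρ₂ l ⇔ lbl ρ₃ l) → (ρ₁ +ᴿ ρ₂) ∩ (ρ₁ +ᴿ ρ₃) ≃ ρ₁ +ᴿ (ρ₂ ∩ ρ₃))
lemma3p10 ρ₁ ρ₂ ρ₃ r₁ r₂ r₃ =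
  ≃⇒≈ₗ , #ₗ⇒+≃∩ r₁ r₂ , ⊆ₗ⇒+-overridden r₁ r₂ , ≈ₗ⇒+-distribˡ-∩ r₁ r₂ r₃
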